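{- Let $(B,\cdot,\circ)$ be a skew left brace and $(B,\lambda,\rho)$ its associated solution. Then (i) $\lambda_{\lambda_x(y)}=\lambda_y$ for all $x,y\in B$ if and only if $a\mapsto\lambda_a$ is a group homomorphism $(B,\cdot)\to\mathrm{Aut}(B,\cdot)$, i.e. $\lambda_{a\cdot b}=\lambda_a\lambda_b$; (ii) $\rho_{\rho_x(y)}=\rho_y$ for all $x,y\in B$ if and only if $a\mapsto\rho_a$ is a group homomorphism $(B,\cdot)\to S_B$ (the symmetric group on $B$); (iii) $\lambda_{\rho_x(y)}=\lambda_y$ for all $x,y\in B$ if and only if $a\mapsto\lambda_a$ is an anti-homomorphism of groups $(B,\cdot)\to\mathrm{Aut}(B,\cdot)$, i.e. $\lambda_{a\cdot b}=\lambda_b\lambda_a$; (iv) $\rho_{\lambda_x(y)}=\rho_y$ for all $x,y\in B$ if and only if $a\mapsto\rho_a$ is an anti-homomorphism of groups $(B,\cdot)\to\mathrm{Aut}(B,\cdot)$.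
   Context: A skew left brace is $(B,\cdot,\circ)$ with $(B,\cdot)$ and $(B,\circ)$ groups such that $a\circ(b\cdot c)=(a\circ b)\cdot a^{ -1}\cdot(a\circ c)$ for all $a,b,c\in B$; $a^{ -1}$ denotes the inverse in $(B,\cdot)$ and $\bar a$ the inverse in $(B,\circ)$. Define $\lambda_a(b)=a^{ -1}\cdot(a\circ b)$ (an automorphism of $(B,\cdot)$) and $\rho_b(a)=\overline{\lambda_a(b)}\circ a\circ b$. The associated solution is $(B,\lambda,\rho)$, i.e. the map $r(a,b)=(\lambda_a(b),\rho_b(a))$. -}

module Defs where

open import Level using (Level; suc)
open import Algebra.Structures using (IsGroup)
open import Relation.Binary.PropositionalEquality using (_≡_)

record SkewLeftBrace (ℓ : Level) : Set (suc ℓ) where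
  infixl 7 _·_
  infixl 7 _⊚_
  field
    Carrier : Set ℓ
    _·_     : Carrier → Carrier → Carrier
    ε       : Carrier
    _⁻¹     : Carrier → Carrier
    _⊚_     : Carrier → Carrier → Carrier
    e       : Carrier
    bar     : Carrier → Carrier
    ·-isGroup : IsGroup _≡_ _·_ ε _⁻¹
    ⊚-isGroup : IsGroup _≡_ _⊚_ e bar
    brace   : ∀ a b c → a ⊚ (b · c) ≡ (a ⊚ b) · (a ⁻¹) · (a ⊚ c)

  lam : Carrier → Carrier → Carrier
  lam a b = (a ⁻¹) · (a ⊚ b)

  rho : Carrier → Carrier → Carrier
  rho b a = bar (lam a b) ⊚ a ⊚ b

{-# OPTIONS --safe #-}
-- λ is a left action and ρ a right action of (B,∘) on B, and a · b = a ∘ w with λ_a(w) = b,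
-- namely w = λ_ā(b). Hence the value of either action at a · b is its value at a ∘ w, or,
-- via λ_a(w) ∘ ρ_w(a) = a ∘ w, at λ_a(w) ∘ ρ_w(a); the invariance hypothesis then removes
-- the inner λ or ρ. Conversely, a ∘ y = a · λ_a(y) runs the same computation backwards, and
-- the extra action of a that it leaves over is cancelled because every action map is bijective.
module Submission where

open import Defs
open import Level using (Level)
open import Data.Product using (_×_; _,_)
open import Function.Bundles using (_⇔_; mk⇔)
open import Relation.Binary.PropositionalEquality
  using (_≡_; sym; trans; cong; cong₂; module ≡-Reasoning)
open import Algebra.Bundles using (Group)
import Algebra.Properties.Group as GroupProperties

module SkewLeftBraceProperties {ℓ : Level} (B : SkewLeftBrace ℓ) where
  open SkewLeftBrace B
  open ≡-Reasoning

  ·-group : Group ℓ ℓ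
  ·-group = record { isGroup = ·-isGroup }

  ⊚-group : Group ℓ ℓ
  ⊚-group = record { isGroup = ⊚-isGroup }

  open Group ·-group using (assoc; identityˡ; identityʳ)
  open GroupProperties ·-group using (\\-leftDividesˡ; \\-leftDividesʳ; identityʳ-unique)
  module ⊚ = Group ⊚-group
  module ⊚-Properties = GroupProperties ⊚-group

  Action : Set ℓ
  Action = Carrier → Carrier → Carrier

  Homomorphic : Action → (Carrier → Carrier → Carrier) → Set ℓ
  Homomorphic f _∙_ = ∀ a b z → f (a ∙ b) z ≡ f a (f b z)

  AntiHomomorphic : Action → (Carrier → Carrier → Carrier) → Set ℓ
  AntiHomomorphic f _∙_ = ∀ a b z → f (a ∙ b) z ≡ f b (f a z)

  InvariantUnder : Action → (Carrier → Carrier → Carrier) → Set ℓ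
  InvariantUnder f g = ∀ x y z → f (g x y) z ≡ f y z

  -- lam a b is definitionally a \\ (a ⊚ b) in the group (B,·).
  ⊚≡·-lam : ∀ a b → a ⊚ b ≡ a · lam a b
  ⊚≡·-lam a b = sym (\\-leftDividesˡ a (a ⊚ b))

  lam-homo-· : ∀ a b c → lam a (b · c) ≡ lam a b · lam a c
  lam-homo-· a b c = begin
    a ⁻¹ · (a ⊚ (b · c))                 ≡⟨ cong (a ⁻¹ ·_) (brace a b c) ⟩
    a ⁻¹ · ((a ⊚ b) · a ⁻¹ · (a ⊚ c))    ≡⟨ cong (a ⁻¹ ·_) (assoc _ _ _) ⟩
    a ⁻¹ · ((a ⊚ b) · (a ⁻¹ · (a ⊚ c)))  ≡⟨ assoc _ _ _ ⟨
    lam a b · lam a c                    ∎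

  lam-ε : ∀ a → lam a ε ≡ ε
  lam-ε a = identityʳ-unique (lam a ε) (lam a ε) (begin
    lam a ε · lam a ε  ≡⟨ lam-homo-· a ε ε ⟨
    lam a (ε · ε)      ≡⟨ cong (lam a) (identityˡ ε) ⟩
    lam a ε            ∎)

  e≡ε : e ≡ ε
  e≡ε = begin
    e             ≡⟨ identityʳ e ⟨
    e · ε         ≡⟨ cong (e ·_) (lam-ε e) ⟨
    e · lam e ε   ≡⟨ ⊚≡·-lam e ε ⟨
    e ⊚ ε         ≡⟨ ⊚.identityˡ ε ⟩
    ε             ∎

  lam-e : ∀ c → lam e c ≡ c
  lam-e c = begin
    lam e c       ≡⟨ identityˡ (lam e c) ⟨
    ε · lam e c   ≡⟨ cong (_· lam e c) e≡ε ⟨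
    e · lam e c   ≡⟨ ⊚≡·-lam e c ⟨
    e ⊚ c         ≡⟨ ⊚.identityˡ c ⟩
    c             ∎

  lam-homo-⊚ : Homomorphic lam _⊚_
  lam-homo-⊚ a b c = begin
    (a ⊚ b) ⁻¹ · ((a ⊚ b) ⊚ c)                    ≡⟨ cong ((a ⊚ b) ⁻¹ ·_) (⊚.assoc a b c) ⟩
    (a ⊚ b) ⁻¹ · (a ⊚ (b ⊚ c))                    ≡⟨ cong (λ t → (a ⊚ b) ⁻¹ · (a ⊚ t)) (⊚≡·-lam b c) ⟩
    (a ⊚ b) ⁻¹ · (a ⊚ (b · lam b c))              ≡⟨ cong ((a ⊚ b) ⁻¹ ·_) (brace a b (lam b c)) ⟩
    (a ⊚ b) ⁻¹ · ((a ⊚ b) · a ⁻¹ · (a ⊚ lam b c)) ≡⟨ cong ((a ⊚ b) ⁻¹ ·_) (assoc _ _ _) ⟩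
    (a ⊚ b) ⁻¹ · ((a ⊚ b) · lam a (lam b c))      ≡⟨ \\-leftDividesʳ (a ⊚ b) _ ⟩
    lam a (lam b c)                               ∎

  lam-lam-bar : ∀ a c → lam a (lam (bar a) c) ≡ c
  lam-lam-bar a c = begin
    lam a (lam (bar a) c)  ≡⟨ lam-homo-⊚ a (bar a) c ⟨
    lam (a ⊚ bar a) c      ≡⟨ cong (λ t → lam t c) (⊚.inverseʳ a) ⟩
    lam e c                ≡⟨ lam-e c ⟩
    c                      ∎

  ·≡⊚-lam-bar : ∀ a b → a · b ≡ a ⊚ lam (bar a) b
  ·≡⊚-lam-bar a b = begin
    a · b                      ≡⟨ cong (a ·_) (lam-lam-bar a b) ⟨
    a · lam a (lam (bar a) b)  ≡⟨ ⊚≡·-lam a _ ⟨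
    a ⊚ lam (bar a) b          ∎

  lam-⊚-rho : ∀ a b → lam a b ⊚ rho b a ≡ a ⊚ b
  lam-⊚-rho a b = begin
    u ⊚ (bar u ⊚ a ⊚ b)    ≡⟨ ⊚.assoc _ _ _ ⟨
    u ⊚ (bar u ⊚ a) ⊚ b    ≡⟨ cong (_⊚ b) (⊚.assoc _ _ _) ⟨
    u ⊚ bar u ⊚ a ⊚ b      ≡⟨ cong (λ t → t ⊚ a ⊚ b) (⊚.inverseʳ u) ⟩
    e ⊚ a ⊚ b              ≡⟨ cong (_⊚ b) (⊚.identityˡ a) ⟩
    a ⊚ b                  ∎
    where u = lam a b

  lam-⊚-cocycle : ∀ a b c → lam a (b ⊚ c) ≡ lam a b ⊚ lam (rho b a) c
  lam-⊚-cocycle a b c = sym (begin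
    lam a b ⊚ lam (rho b a) c                  ≡⟨ ⊚≡·-lam _ _ ⟩
    lam a b · lam (lam a b) (lam (rho b a) c)  ≡⟨ cong (lam a b ·_) (lam-homo-⊚ _ _ _) ⟨
    lam a b · lam (lam a b ⊚ rho b a) c        ≡⟨ cong (λ t → lam a b · lam t c) (lam-⊚-rho a b) ⟩
    lam a b · lam (a ⊚ b) c                    ≡⟨ cong (lam a b ·_) (lam-homo-⊚ a b c) ⟩
    lam a b · lam a (lam b c)                  ≡⟨ lam-homo-· a b (lam b c) ⟨
    lam a (b · lam b c)                        ≡⟨ cong (lam a) (⊚≡·-lam b c) ⟨
    lam a (b ⊚ c)                              ∎)

  rho-antihomo-⊚ : AntiHomomorphic rho _⊚_
  rho-antihomo-⊚ b c a = begin
    bar (lam a (b ⊚ c)) ⊚ a ⊚ (b ⊚ c)  ≡⟨ cong (λ t → bar t ⊚ a ⊚ (b ⊚ c)) (lam-⊚-cocycle a b c) ⟩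
    bar (p ⊚ q) ⊚ a ⊚ (b ⊚ c)          ≡⟨ cong (λ t → t ⊚ a ⊚ (b ⊚ c)) (⊚-Properties.⁻¹-anti-homo-∙ p q) ⟩
    bar q ⊚ bar p ⊚ a ⊚ (b ⊚ c)        ≡⟨ ⊚.assoc _ _ _ ⟨
    bar q ⊚ bar p ⊚ a ⊚ b ⊚ c          ≡⟨ cong (λ t → t ⊚ b ⊚ c) (⊚.assoc _ _ _) ⟩
    bar q ⊚ (bar p ⊚ a) ⊚ b ⊚ c        ≡⟨ cong (_⊚ c) (⊚.assoc _ _ _) ⟩
    bar q ⊚ (bar p ⊚ a ⊚ b) ⊚ c        ∎
    where
    p = lam a b
    q = lam (rho b a) c

  rho-e : ∀ a → rho e a ≡ a
  rho-e a = begin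
    bar (lam a e) ⊚ a ⊚ e  ≡⟨ ⊚.identityʳ _ ⟩
    bar (lam a e) ⊚ a      ≡⟨ cong (λ t → bar t ⊚ a) lam-a-e ⟩
    bar e ⊚ a              ≡⟨ cong (_⊚ a) ⊚-Properties.ε⁻¹≈ε ⟩
    e ⊚ a                  ≡⟨ ⊚.identityˡ a ⟩
    a                      ∎
    where
    lam-a-e : lam a e ≡ e
    lam-a-e = trans (cong (lam a) e≡ε) (trans (lam-ε a) (sym e≡ε))

  module LeftAction (f : Action) (f-homo : Homomorphic f _⊚_) (f-e : ∀ z → f e z ≡ z) where

    injective : ∀ a {x y} → f a x ≡ f a y → x ≡ y
    injective a {x} {y} fx≡fy = begin
      x                  ≡⟨ bar-act x ⟨
      f (bar a) (f a x)  ≡⟨ cong (f (bar a)) fx≡fy ⟩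
      f (bar a) (f a y)  ≡⟨ bar-act y ⟩
      y                  ∎
      where
      bar-act : ∀ z → f (bar a) (f a z) ≡ z
      bar-act z = trans (sym (f-homo (bar a) a z)) (trans (cong (λ t → f t z) (⊚.inverseˡ a)) (f-e z))

    invariantUnder-lam⇔homo-· : InvariantUnder f lam ⇔ Homomorphic f _·_
    invariantUnder-lam⇔homo-· = mk⇔ to from
      where
      to : InvariantUnder f lam → Homomorphic f _·_
      to inv a b z = begin
        f (a · b) z                  ≡⟨ cong (λ t → f t z) (·≡⊚-lam-bar a b) ⟩
        f (a ⊚ lam (bar a) b) z      ≡⟨ f-homo a _ z ⟩
        f a (f (lam (bar a) b) z)    ≡⟨ cong (f a) (inv (bar a) b z) ⟩
        f a (f b z)                  ∎

      from : Homomorphic f _·_ → InvariantUnder f lam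
      from homo x y z = injective x (begin
        f x (f (lam x y) z)  ≡⟨ homo x (lam x y) z ⟨
        f (x · lam x y) z    ≡⟨ cong (λ t → f t z) (⊚≡·-lam x y) ⟨
        f (x ⊚ y) z          ≡⟨ f-homo x y z ⟩
        f x (f y z)          ∎)

    invariantUnder-rho⇔antihomo-· : InvariantUnder f rho ⇔ AntiHomomorphic f _·_
    invariantUnder-rho⇔antihomo-· = mk⇔ to from
      where
      to : InvariantUnder f rho → AntiHomomorphic f _·_
      to inv a b z = begin
        f (a · b) z                    ≡⟨ cong (λ t → f t z) (·≡⊚-lam-bar a b) ⟩
        f (a ⊚ w) z                    ≡⟨ cong (λ t → f t z) (lam-⊚-rho a w) ⟨
        f (lam a w ⊚ rho w a) z        ≡⟨ f-homo _ _ z ⟩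
        f (lam a w) (f (rho w a) z)    ≡⟨ cong₂ f (lam-lam-bar a b) (inv w a z) ⟩
        f b (f a z)                    ∎
        where w = lam (bar a) b

      from : AntiHomomorphic f _·_ → InvariantUnder f rho
      from antihomo x y z = injective (lam y x) (begin
        f (lam y x) (f (rho x y) z)  ≡⟨ f-homo _ _ z ⟨
        f (lam y x ⊚ rho x y) z      ≡⟨ cong (λ t → f t z) (lam-⊚-rho y x) ⟩
        f (y ⊚ x) z                  ≡⟨ cong (λ t → f t z) (⊚≡·-lam y x) ⟩
        f (y · lam y x) z            ≡⟨ antihomo y (lam y x) z ⟩
        f (lam y x) (f y z)          ∎)

  module RightAction (f : Action) (f-antihomo : AntiHomomorphic f _⊚_) (f-e : ∀ z → f e z ≡ z) where

    act-bar : ∀ a z → f a (f (bar a) z) ≡ z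
    act-bar a z = trans (sym (f-antihomo (bar a) a z)) (trans (cong (λ t → f t z) (⊚.inverseˡ a)) (f-e z))

    invariantUnder-lam⇔antihomo-· : InvariantUnder f lam ⇔ AntiHomomorphic f _·_
    invariantUnder-lam⇔antihomo-· = mk⇔ to from
      where
      to : InvariantUnder f lam → AntiHomomorphic f _·_
      to inv a b z = begin
        f (a · b) z                  ≡⟨ cong (λ t → f t z) (·≡⊚-lam-bar a b) ⟩
        f (a ⊚ w) z                  ≡⟨ f-antihomo a w z ⟩
        f w (f a z)                  ≡⟨ inv a w _ ⟨
        f (lam a w) (f a z)          ≡⟨ cong (λ t → f t (f a z)) (lam-lam-bar a b) ⟩
        f b (f a z)                  ∎
        where w = lam (bar a) b

      from : AntiHomomorphic f _·_ → InvariantUnder f lam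
      from antihomo x y z = begin
        f (lam x y) z          ≡⟨ cong (f (lam x y)) (act-bar x z) ⟨
        f (lam x y) (f x w)    ≡⟨ antihomo x (lam x y) w ⟨
        f (x · lam x y) w      ≡⟨ cong (λ t → f t w) (⊚≡·-lam x y) ⟨
        f (x ⊚ y) w            ≡⟨ f-antihomo x y w ⟩
        f y (f x w)            ≡⟨ cong (f y) (act-bar x z) ⟩
        f y z                  ∎
        where w = f (bar x) z

    invariantUnder-rho⇔homo-· : InvariantUnder f rho ⇔ Homomorphic f _·_
    invariantUnder-rho⇔homo-· = mk⇔ to from
      where
      to : InvariantUnder f rho → Homomorphic f _·_
      to inv a b z = begin
        f (a · b) z                    ≡⟨ cong (λ t → f t z) (·≡⊚-lam-bar a b) ⟩
        f (a ⊚ w) z                    ≡⟨ cong (λ t → f t z) (lam-⊚-rho a w) ⟨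
        f (lam a w ⊚ rho w a) z        ≡⟨ f-antihomo _ _ z ⟩
        f (rho w a) (f (lam a w) z)    ≡⟨ inv w a _ ⟩
        f a (f (lam a w) z)            ≡⟨ cong (λ t → f a (f t z)) (lam-lam-bar a b) ⟩
        f a (f b z)                    ∎
        where w = lam (bar a) b

      from : Homomorphic f _·_ → InvariantUnder f rho
      from homo x y z = begin
        f (rho x y) z          ≡⟨ cong (f (rho x y)) (act-bar u z) ⟨
        f (rho x y) (f u w)    ≡⟨ f-antihomo u (rho x y) w ⟨
        f (u ⊚ rho x y) w      ≡⟨ cong (λ t → f t w) (lam-⊚-rho y x) ⟩
        f (y ⊚ x) w            ≡⟨ cong (λ t → f t w) (⊚≡·-lam y x) ⟩
        f (y · u) w            ≡⟨ homo y u w ⟩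
        f y (f u w)            ≡⟨ cong (f y) (act-bar u z) ⟩
        f y z                  ∎
        where
        u = lam y x
        w = f (bar u) z

proposition6p1 : ∀ {ℓ : Level} (B : SkewLeftBrace ℓ) → let open SkewLeftBrace B in
    ((∀ x y z → lam (lam x y) z ≡ lam y z) ⇔ (∀ a b z → lam (a · b) z ≡ lam a (lam b z)))
    × ((∀ x y z → rho (rho x y) z ≡ rho y z) ⇔ (∀ a b z → rho (a · b) z ≡ rho a (rho b z)))
    × ((∀ x y z → lam (rho x y) z ≡ lam y z) ⇔ (∀ a b z → lam (a · b) z ≡ lam b (lam a z)))
    × ((∀ x y z → rho (lam x y) z ≡ rho y z) ⇔ (∀ a b z → rho (a · b) z ≡ rho b (rho a z)))
proposition6p1 B =
  Lam.invariantUnder-lam⇔homo-· , Rho.invariantUnder-rho⇔homo-· ,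
  Lam.invariantUnder-rho⇔antihomo-· , Rho.invariantUnder-lam⇔antihomo-·
  where
  open SkewLeftBrace B using (lam; rho)
  open SkewLeftBraceProperties B
  module Lam = LeftAction lam lam-homo-⊚ lam-e
  module Rho = RightAction rho rho-antihomo-⊚ rho-e
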